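{- Let $l_1,l_2$ and $t$ be positive integers such that $l=\min(l_1,l_2)\geq t+2$. Then there exists a constant $n_0=n_0(l_1,l_2,t)$ depending only on $l_1,l_2$ and $t$ such that the following holds for all $n_1,n_2\geq n_0$: if families $\mathcal A_1\subseteq P(n_1,l_1)$ and $\mathcal A_2\subseteq P(n_2,l_2)$ are $2$-cross $t$-intersecting, then \[ |\mathcal A_1|\,|\mathcal A_2|\leq \binom{n_1+l_1-t-1}{l_1-t-1}\binom{n_2+l_2-t-1}{l_2-t-1}. \] Moreover, equality holds if and only if there is a $t$-element subset $T$ of $\{1,2,\dots,l\}$ such that $\mathcal A_1=\{\mathbf u\in P(n_1,l_1) : \mathbf u(i)=0 \text{ for all } i\in T\}$ and $\mathcal A_2=\{\mathbf u\in P(n_2,l_2) : \mathbf u(i)=0 \text{ for all } i\in T\}$.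
   Context: $\mathbb N_0$ denotes the set of non-negative integers. For positive integers $n,l$, $P(n,l)=\{(x_1,\dots,x_l)\in\mathbb N_0^l : x_1+\cdots+x_l=n\}$ is the set of weak compositions of $n$ with $l$ parts; for $\mathbf u=(u_1,\dots,u_l)\in P(n,l)$, $\mathbf u(i)=u_i$ denotes its $i$-th coordinate. For $\mathbf u_1\in P(n_1,l_1)$, $\mathbf u_2\in P(n_2,l_2)$ and $l=\min(l_1,l_2)$, let $I(\mathbf u_1,\mathbf u_2)=\{i\in\{1,\dots,l\} : \mathbf u_1(i)=\mathbf u_2(i)\}$. Families $\mathcal A_1\subseteq P(n_1,l_1)$, $\mathcal A_2\subseteq P(n_2,l_2)$ are $2$-cross $t$-intersecting if $|I(\mathbf u_1,\mathbf u_2)|\ge t$ for all $\mathbf u_1\in\mathcal A_1$, $\mathbf u_2\in\mathcal A_2$. -}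

module Defs where

open import Data.Nat using (ℕ; _⊓_; _≟_)
open import Data.Nat.Properties using (m⊓n≤m; m⊓n≤n)
open import Data.Fin using (Fin; inject≤)
open import Data.Fin.Subset using (Subset; _∈_)
open import Data.Vec using (Vec; lookup; toList)
open import Data.List using (List; length; filter; zip)
import Data.List.Membership.Propositional as L
open import Data.List.Relation.Unary.All using (All)
open import Data.List.Relation.Unary.Unique.Propositional using (Unique)
open import Data.Product using (_×_; proj₁; proj₂)
open import Relation.Binary.PropositionalEquality using (_≡_)
open import Function.Bundles using (_⇔_)

-- A weak composition of n with l parts: a vector (x_1,…,x_l) of naturals with sum n.
-- We use Data.Vec.sum.
open import Data.Vec using (sum) public

-- A family A ⊆ P(n,l), given as a duplicate-free list of compositions of n into l parts.
-- Its cardinality |A| is  length A.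
IsFamily : (n : ℕ) {l : ℕ} → List (Vec ℕ l) → Set
IsFamily n A = Unique A × All (λ u → sum u ≡ n) A

agree : {l1 l2 : ℕ} → Vec ℕ l1 → Vec ℕ l2 → ℕ
agree u1 u2 = length (filter (λ p → proj₁ p ≟ proj₂ p) (zip (toList u1) (toList u2)))

CrossInt : (t : ℕ) {l1 l2 : ℕ} → List (Vec ℕ l1) → List (Vec ℕ l2) → Set
CrossInt t {l1} {l2} A1 A2 =
  ∀ u1 u2 → u1 L.∈ A1 → u2 L.∈ A2 → t Data.Nat.≤ agree u1 u2

inj₁ : {l1 l2 : ℕ} → Fin (l1 ⊓ l2) → Fin l1
inj₁ {l1} {l2} i = inject≤ i (m⊓n≤m l1 l2)

inj₂ : {l1 l2 : ℕ} → Fin (l1 ⊓ l2) → Fin l2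
inj₂ {l1} {l2} i = inject≤ i (m⊓n≤n l1 l2)

IsStar : (n : ℕ) {m l : ℕ} (ι : Fin m → Fin l) (T : Subset m) → List (Vec ℕ l) → Set
IsStar n ι T A = ∀ (u : Vec ℕ _) →
  (u L.∈ A) ⇔ (sum u ≡ n × (∀ i → i ∈ T → lookup u (ι i) ≡ 0))

-- Write m = l1 ⊓ l2 and |P(n,l)| = C(n+l−1, l−1).  Prescribing s coordinates of a composition
-- leaves at most |P(n, l−s)| of them, and |P(n, l−t−1)| is only an O(1/n) fraction of |P(n, l−t)|.
-- Every member of A1 agrees with a fixed v ∈ A2 on t of the first m coordinates, so A1 is covered
-- by the at most 2^m t-stars around v.  If each of them meets A1 in at most m·|P(n1, l1−t−1)|
-- elements, A1 is so small that the product bound is strict.  Otherwise one t-star, of pattern P,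
-- meets A1 in many elements; an element of A2 missing P would push all of them into m stars with
-- t+1 prescribed coordinates, so all of A2 matches P, and by the same argument (unless A2 is small)
-- so does all of A1.  Both families then lie in stars of P, of size at most the binomials, with
-- equality only when P prescribes zeros and the families fill these stars.

module Submission where

open import Defs
open import Data.Nat using (ℕ; _+_; _*_; _∸_; _≤_; _⊓_)
open import Data.Nat.Combinatorics using (_C_)
open import Data.Vec using (Vec)
open import Data.List using (List; length)
open import Data.Fin.Subset using (Subset; ∣_∣)
open import Data.Product using (_×_; ∃-syntax)
open import Relation.Binary.PropositionalEquality using (_≡_)
open import Function.Bundles using (_⇔_)

open import Data.Nat using (zero; suc; _<_; _^_; z≤n; s≤s; s≤s⁻¹; _≟_; _≤?_; _<?_; >-nonZero)
open import Data.Nat.Properties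
open import Data.Nat.Combinatorics using (nCk+nC[k+1]≡[n+1]C[k+1]; nCn≡1)
open import Data.Nat.ListAction using () renaming (sum to sumᴸ)
open import Data.Maybe using (Maybe; just; nothing)
open import Data.Fin using (Fin; zero; suc; inject≤)
open import Data.Fin.Subset using (inside; outside) renaming (_∈_ to _∈ₛ_)
open import Data.Vec using ([]; _∷_; lookup; replicate; toList; here; there)
open import Data.Vec.Properties using (≡-dec)
open import Data.List using ([]; _∷_; map; _++_; filter; zip; allFin)
open import Data.List.Properties using (length-++; length-map; length-filter; length-tabulate; filter-accept; filter-reject; filter-none)
open import Data.List.Membership.Propositional using (_∈_; _∉_; find)
open import Data.List.Membership.Propositional.Properties
  using (∈-∃++; ∈-++⁻; ∈-++⁺ˡ; ∈-++⁺ʳ; ∈-map⁻; ∈-map⁺; ∈-filter⁺; ∈-filter⁻; ∈-allFin)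
import Data.List.Membership.DecPropositional as DecMembership
open import Data.List.Relation.Binary.Subset.Propositional using (_⊆_)
open import Data.List.Relation.Unary.Any using (here; there; any?)
open import Data.List.Relation.Unary.All as All using (All; [])
open import Data.List.Relation.Unary.All.Properties using (¬Any⇒All¬)
open import Data.List.Relation.Unary.AllPairs using ([]; _∷_)
open import Data.List.Relation.Unary.Unique.Propositional using (Unique)
import Data.List.Relation.Unary.Unique.Propositional.Properties as Unique
open import Data.Product using (Σ; _,_; proj₁; proj₂)
open import Data.Sum using (_⊎_) renaming (inj₁ to left; inj₂ to right)
open import Data.Unit using (⊤; tt)
open import Data.Empty using (⊥; ⊥-elim)
open import Relation.Binary.PropositionalEquality using (_≢_; refl; sym; trans; cong; cong₂; subst; module ≡-Reasoning)
open import Relation.Nullary using (¬_; Dec; yes; no; contradiction)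
open import Relation.Nullary.Decidable using (_×-dec_)
open import Relation.Unary using (Decidable)
open import Relation.Binary.Definitions using (DecidableEquality)
open import Function.Bundles using (mk⇔; Equivalence)
open import Function using (_∘_)

-- nComp l n = |P(n,l)|; the recursion splits on whether the first part is zero.
nComp : ℕ → ℕ → ℕ
nComp zero    zero    = 1
nComp zero    (suc n) = 0
nComp (suc l) zero    = nComp l zero
nComp (suc l) (suc n) = nComp l (suc n) + nComp (suc l) n

nComp-zero : ∀ l → nComp l 0 ≡ 1
nComp-zero zero    = refl
nComp-zero (suc l) = nComp-zero l

nComp-pos : ∀ l n → 1 ≤ nComp (suc l) n
nComp-pos l zero    = ≤-reflexive (sym (nComp-zero l))
nComp-pos l (suc n) = ≤-trans (nComp-pos l n) (m≤n+m _ _)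

nComp-mono : ∀ l {m n} → m ≤ n → nComp (suc l) m ≤ nComp (suc l) n
nComp-mono l {m} m≤n with m≤n⇒∃[o]m+o≡n m≤n
... | o , refl = go o
  where
  go : ∀ o → nComp (suc l) m ≤ nComp (suc l) (m + o)
  go zero    = ≤-reflexive (cong (nComp (suc l)) (sym (+-identityʳ m)))
  go (suc o) = ≤-trans (go o) (≤-trans (m≤n+m _ _) (≤-reflexive (cong (nComp (suc l)) (sym (+-suc m o)))))

nComp-strictMono : ∀ l {m n} → m < n → nComp (suc (suc l)) m < nComp (suc (suc l)) n
nComp-strictMono l {m} {suc n} (s≤s m≤n) =
  <-≤-trans (+-monoˡ-≤ (nComp (suc (suc l)) m) (nComp-pos l (suc m))) (nComp-mono (suc l) (s≤s m≤n))

nComp≡C : ∀ l n → nComp (suc l) n ≡ (n + l) C l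
nComp≡C zero    zero    = refl
nComp≡C zero    (suc n) = nComp≡C zero n
nComp≡C (suc l) zero    = trans (nComp≡C l zero) (trans (nCn≡1 l) (sym (nCn≡1 (suc l))))
nComp≡C (suc l) (suc n) = begin
  nComp (suc l) (suc n) + nComp (suc (suc l)) n
    ≡⟨ cong₂ _+_ (nComp≡C l (suc n)) (nComp≡C (suc l) n) ⟩
  (suc n + l) C l + (n + suc l) C (suc l)
    ≡⟨ cong (λ k → k C l + (n + suc l) C (suc l)) (sym (+-suc n l)) ⟩
  (n + suc l) C l + (n + suc l) C (suc l)
    ≡⟨ nCk+nC[k+1]≡[n+1]C[k+1] (n + suc l) l ⟩
  suc (n + suc l) C suc l ∎
  where open ≡-Reasoning

mutual
  nComp-absorb : ∀ l n → l * nComp (suc l) n ≡ (n + l) * nComp l n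
  nComp-absorb l zero    = cong (l *_) (trans (nComp-zero (suc l)) (sym (nComp-zero l)))
  nComp-absorb l (suc n) = begin
    l * (nComp l (suc n) + nComp (suc l) n)     ≡⟨ *-distribˡ-+ l (nComp l (suc n)) (nComp (suc l) n) ⟩
    l * nComp l (suc n) + l * nComp (suc l) n   ≡⟨ cong (l * nComp l (suc n) +_) (nComp-absorb l n) ⟩
    l * nComp l (suc n) + (n + l) * nComp l n   ≡⟨ cong (l * nComp l (suc n) +_) (sym (nComp-shift l n)) ⟩
    l * nComp l (suc n) + suc n * nComp l (suc n) ≡⟨ sym (*-distribʳ-+ (nComp l (suc n)) l (suc n)) ⟩
    (l + suc n) * nComp l (suc n)               ≡⟨ cong (_* nComp l (suc n)) (+-comm l (suc n)) ⟩
    (suc n + l) * nComp l (suc n)               ∎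
    where open ≡-Reasoning

  nComp-shift : ∀ l n → suc n * nComp l (suc n) ≡ (n + l) * nComp l n
  nComp-shift zero zero    = refl
  nComp-shift zero (suc n) = trans (*-zeroʳ (suc (suc n))) (sym (*-zeroʳ (suc n + 0)))
  nComp-shift (suc l) n = begin
    suc n * (nComp l (suc n) + nComp (suc l) n)       ≡⟨ *-distribˡ-+ (suc n) (nComp l (suc n)) (nComp (suc l) n) ⟩
    suc n * nComp l (suc n) + suc n * nComp (suc l) n ≡⟨ cong (_+ suc n * nComp (suc l) n) (nComp-shift l n) ⟩
    (n + l) * nComp l n + suc n * nComp (suc l) n     ≡⟨ cong (_+ suc n * nComp (suc l) n) (sym (nComp-absorb l n)) ⟩
    l * nComp (suc l) n + suc n * nComp (suc l) n     ≡⟨ sym (*-distribʳ-+ (nComp (suc l) n) l (suc n)) ⟩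
    (l + suc n) * nComp (suc l) n                     ≡⟨ cong (_* nComp (suc l) n) (trans (+-comm l (suc n)) (sym (+-suc n l))) ⟩
    (n + suc l) * nComp (suc l) n                     ∎
    where open ≡-Reasoning

-- nComp (l + 2) n / nComp (l + 1) n = (n + l + 1)/(l + 1), which exceeds K once n ≥ K(l + 1).
nComp-ratio : ∀ K l n → K * suc l ≤ n → K * nComp (suc l) n < nComp (suc (suc l)) n
nComp-ratio K l n K[l+1]≤n = *-cancelˡ-< (suc l) _ _ (begin-strict
  suc l * (K * a)   ≡⟨ sym (*-assoc (suc l) K a) ⟩
  (suc l * K) * a   ≡⟨ cong (_* a) (*-comm (suc l) K) ⟩
  (K * suc l) * a   ≤⟨ *-monoˡ-≤ a K[l+1]≤n ⟩
  n * a             <⟨ m<m+n (n * a) (≤-trans (nComp-pos l n) (m≤m+n a (l * a))) ⟩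
  n * a + suc l * a ≡⟨ sym (*-distribʳ-+ a n (suc l)) ⟩
  (n + suc l) * a   ≡⟨ sym (nComp-absorb (suc l) n) ⟩
  suc l * nComp (suc (suc l)) n ∎)
  where
  a : ℕ
  a = nComp (suc l) n
  open ≤-Reasoning

module _ {X : Set} where

  private
    ∈-remove : ∀ {x y : X} (ys zs : List X) → x ∈ ys ++ y ∷ zs → x ≢ y → x ∈ ys ++ zs
    ∈-remove []       zs (here refl) x≢y = ⊥-elim (x≢y refl)
    ∈-remove []       zs (there x∈)  x≢y = x∈
    ∈-remove (w ∷ ys) zs (here x≡w)  x≢y = here x≡w
    ∈-remove (w ∷ ys) zs (there x∈)  x≢y = there (∈-remove ys zs x∈ x≢y)

    length-++-∷ : ∀ (ys zs : List X) y → length (ys ++ y ∷ zs) ≡ suc (length (ys ++ zs))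
    length-++-∷ []       zs y = refl
    length-++-∷ (w ∷ ys) zs y = cong suc (length-++-∷ ys zs y)

  Unique-length-≤ : ∀ {xs ys : List X} → Unique xs → xs ⊆ ys → length xs ≤ length ys
  Unique-length-≤ {[]}     _          _     = z≤n
  Unique-length-≤ {x ∷ xs} (x∉ ∷ uxs) xs⊆ys with ∈-∃++ (xs⊆ys (here refl))
  ... | ys , zs , refl =
    ≤-trans (s≤s (Unique-length-≤ uxs (λ p → ∈-remove ys zs (xs⊆ys (there p)) (λ e → All.lookup x∉ p (sym e)))))
            (≤-reflexive (sym (length-++-∷ ys zs x)))

  Unique-length-< : ∀ {xs ys : List X} {y} → Unique xs → xs ⊆ ys → y ∈ ys → y ∉ xs → length xs < length ys
  Unique-length-< {xs} uxs xs⊆ys y∈ys y∉xs =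
    Unique-length-≤ (¬Any⇒All¬ xs y∉xs ∷ uxs) λ { (here refl) → y∈ys ; (there p) → xs⊆ys p }

  Unique-⊆-length-≥⇒⊇ : DecidableEquality X → ∀ {xs ys : List X} → Unique xs → xs ⊆ ys → length ys ≤ length xs → ys ⊆ xs
  Unique-⊆-length-≥⇒⊇ _≟ₓ_ {xs} uxs xs⊆ys ys≤xs {y} y∈ys with DecMembership._∈?_ _≟ₓ_ y xs
  ... | yes y∈xs = y∈xs
  ... | no y∉xs  = contradiction ys≤xs (<⇒≱ (Unique-length-< uxs xs⊆ys y∈ys y∉xs))

  empty-or-∈ : (xs : List X) → xs ≡ [] ⊎ Σ X (_∈ xs)
  empty-or-∈ []       = left refl
  empty-or-∈ (x ∷ xs) = right (x , here refl)

module _ {I : Set} where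

  length-*-mono-≤ : (xs : List I) {a b : ℕ} → (∀ {x} → x ∈ xs → a ≤ b) → length xs * a ≤ length xs * b
  length-*-mono-≤ []       a≤b = z≤n
  length-*-mono-≤ (x ∷ xs) a≤b = *-monoʳ-≤ (length (x ∷ xs)) (a≤b (here refl))

  exists-or-all-≤ : (f : I → ℕ) (B : ℕ) (is : List I) → (Σ I λ i → i ∈ is × B < f i) ⊎ (∀ {i} → i ∈ is → f i ≤ B)
  exists-or-all-≤ f B is with any? (λ i → B <? f i) is
  ... | yes some = left (find some)
  ... | no none  = right (λ i∈ → ≮⇒≥ (All.lookup (¬Any⇒All¬ is none) i∈))

  sum-map-mono-≤ : (is : List I) {f g : I → ℕ} → (∀ {i} → i ∈ is → f i ≤ g i) → sumᴸ (map f is) ≤ sumᴸ (map g is)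
  sum-map-mono-≤ []       f≤g = z≤n
  sum-map-mono-≤ (i ∷ is) f≤g = +-mono-≤ (f≤g (here refl)) (sum-map-mono-≤ is (f≤g ∘ there))

  sum-map-mono-< : (is : List I) {f g : I → ℕ} → (∀ {i} → i ∈ is → f i ≤ g i) →
                   ∀ {j} → j ∈ is → f j < g j → sumᴸ (map f is) < sumᴸ (map g is)
  sum-map-mono-< (i ∷ is) f≤g (here refl) fj<gj = +-mono-<-≤ fj<gj (sum-map-mono-≤ is (f≤g ∘ there))
  sum-map-mono-< (i ∷ is) f≤g (there j∈)  fj<gj = +-mono-≤-< (f≤g (here refl)) (sum-map-mono-< is (f≤g ∘ there) j∈ fj<gj)

  sum-map-≤-length* : (is : List I) {f : I → ℕ} {B : ℕ} → (∀ {i} → i ∈ is → f i ≤ B) → sumᴸ (map f is) ≤ length is * B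
  sum-map-≤-length* []       f≤B = z≤n
  sum-map-≤-length* (i ∷ is) f≤B = +-mono-≤ (f≤B (here refl)) (sum-map-≤-length* is (f≤B ∘ there))

length-≤-sum-filter : {X I : Set} (is : List I) {R : I → X → Set} (R? : ∀ i → Decidable (R i)) (xs : List X) →
                      (∀ {x} → x ∈ xs → Σ I λ i → i ∈ is × R i x) →
                      length xs ≤ sumᴸ (map (λ i → length (filter (R? i) xs)) is)
length-≤-sum-filter is R? []       covered = z≤n
length-≤-sum-filter is R? (x ∷ xs) covered with covered (here refl)
... | j , j∈is , Rjx = ≤-trans (s≤s (length-≤-sum-filter is R? xs (covered ∘ there)))
                               (sum-map-mono-< is (λ {i} _ → step (R? i)) j∈is (step< (R? j) Rjx))
  where
  step : {R : _ → Set} (R? : Decidable R) → length (filter R? xs) ≤ length (filter R? (x ∷ xs))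
  step R? with R? x
  ... | yes _ = n≤1+n _
  ... | no _  = ≤-refl
  step< : {R : _ → Set} (R? : Decidable R) → R x → length (filter R? xs) < length (filter R? (x ∷ xs))
  step< R? r with R? x
  ... | yes _ = ≤-refl
  ... | no ¬r = ⊥-elim (¬r r)

-- A pattern prescribes some coordinates (just x) and leaves the others free (nothing).
Pattern : ℕ → Set
Pattern L = Vec (Maybe ℕ) L

Matches : ∀ {L} → Pattern L → Vec ℕ L → Set
Matches []             []      = ⊤
Matches (nothing ∷ P)  (x ∷ u) = Matches P u
Matches (just y ∷ P)   (x ∷ u) = x ≡ y × Matches P u

matches? : ∀ {L} (P : Pattern L) → Decidable (Matches P)
matches? []            []      = yes tt
matches? (nothing ∷ P) (x ∷ u) = matches? P u
matches? (just y ∷ P)  (x ∷ u) = (x ≟ y) ×-dec matches? P u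

fixed : ∀ {L} → Pattern L → ℕ
fixed []            = 0
fixed (nothing ∷ P) = fixed P
fixed (just _ ∷ P)  = suc (fixed P)

free : ∀ {L} → Pattern L → ℕ
free []            = 0
free (nothing ∷ P) = suc (free P)
free (just _ ∷ P)  = free P

fixedSum : ∀ {L} → Pattern L → ℕ
fixedSum []            = 0
fixedSum (nothing ∷ P) = fixedSum P
fixedSum (just x ∷ P)  = x + fixedSum P

free+fixed : ∀ {L} (P : Pattern L) → free P + fixed P ≡ L
free+fixed []            = refl
free+fixed (nothing ∷ P) = cong suc (free+fixed P)
free+fixed (just x ∷ P)  = trans (+-suc (free P) (fixed P)) (cong suc (free+fixed P))

private
  incHead : ∀ {L} → Vec ℕ (suc L) → Vec ℕ (suc L)
  incHead (x ∷ u) = suc x ∷ u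

  incHead-injective : ∀ {L} {u w : Vec ℕ (suc L)} → incHead u ≡ incHead w → u ≡ w
  incHead-injective {u = x ∷ u} {y ∷ w} refl = refl

  ∷-injectiveʳ : ∀ {L} {x : ℕ} {u w : Vec ℕ L} → x ∷ u ≡ x ∷ w → u ≡ w
  ∷-injectiveʳ refl = refl

-- A free first coordinate is enumerated by Pascal's recursion, mirroring nComp.
matching : ∀ {L} → Pattern L → ℕ → List (Vec ℕ L)
matching []           zero    = [] ∷ []
matching []           (suc n) = []
matching (just x ∷ P) n with x ≤? n
... | yes _ = map (x ∷_) (matching P (n ∸ x))
... | no _  = []
matching (nothing ∷ P) zero    = map (0 ∷_) (matching P 0)
matching (nothing ∷ P) (suc n) = map (0 ∷_) (matching P (suc n)) ++ map incHead (matching (nothing ∷ P) n)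

matching-sound : ∀ {L} (P : Pattern L) n {v} → v ∈ matching P n → sum v ≡ n × Matches P v
matching-sound [] zero (here refl) = refl , tt
matching-sound (just x ∷ P) n v∈ with x ≤? n
... | yes x≤n with ∈-map⁻ (x ∷_) v∈
... | w , w∈ , refl with matching-sound P (n ∸ x) w∈
... | Σw , mw = trans (cong (x +_) Σw) (m+[n∸m]≡n x≤n) , refl , mw
matching-sound (just x ∷ P) n () | no _
matching-sound (nothing ∷ P) zero v∈ with ∈-map⁻ (0 ∷_) v∈
... | w , w∈ , refl = matching-sound P 0 w∈
matching-sound (nothing ∷ P) (suc n) v∈ with ∈-++⁻ (map (0 ∷_) (matching P (suc n))) v∈
... | left v∈₀ with ∈-map⁻ (0 ∷_) v∈₀
... | w , w∈ , refl = matching-sound P (suc n) w∈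
matching-sound (nothing ∷ P) (suc n) v∈ | right v∈₊ with ∈-map⁻ incHead v∈₊
... | (y ∷ w) , w∈ , refl with matching-sound (nothing ∷ P) n w∈
... | Σw , mw = cong suc Σw , mw

matching-complete : ∀ {L} (P : Pattern L) n (v : Vec ℕ L) → sum v ≡ n → Matches P v → v ∈ matching P n
matching-complete []           zero    [] Σv mv = here refl
matching-complete (just y ∷ P) n (x ∷ v) Σv (refl , mv) with x ≤? n
... | yes _   = ∈-map⁺ (x ∷_) (matching-complete P (n ∸ x) v (trans (sym (m+n∸m≡n x (sum v))) (cong (_∸ x) Σv)) mv)
... | no x≰n = ⊥-elim (x≰n (subst (x ≤_) Σv (m≤m+n x (sum v))))
matching-complete (nothing ∷ P) zero (zero ∷ v) Σv mv = ∈-map⁺ (0 ∷_) (matching-complete P 0 v Σv mv)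
matching-complete (nothing ∷ P) (suc n) (zero ∷ v) Σv mv =
  ∈-++⁺ˡ (∈-map⁺ (0 ∷_) (matching-complete P (suc n) v Σv mv))
matching-complete (nothing ∷ P) (suc n) (suc x ∷ v) Σv mv =
  ∈-++⁺ʳ (map (0 ∷_) (matching P (suc n)))
         (∈-map⁺ incHead (matching-complete (nothing ∷ P) n (x ∷ v) (suc-injective Σv) mv))

matching-unique : ∀ {L} (P : Pattern L) n → Unique (matching P n)
matching-unique []           zero    = [] ∷ []
matching-unique []           (suc n) = []
matching-unique (just x ∷ P) n with x ≤? n
... | yes _ = Unique.map⁺ ∷-injectiveʳ (matching-unique P (n ∸ x))
... | no _  = []
matching-unique (nothing ∷ P) zero    = Unique.map⁺ ∷-injectiveʳ (matching-unique P 0)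
matching-unique (nothing ∷ P) (suc n) =
  Unique.++⁺ (Unique.map⁺ ∷-injectiveʳ (matching-unique P (suc n)))
             (Unique.map⁺ incHead-injective (matching-unique (nothing ∷ P) n)) disjoint
  where
  disjoint : ∀ {v} → v ∈ map (0 ∷_) (matching P (suc n)) × v ∈ map incHead (matching (nothing ∷ P) n) → ⊥
  disjoint (p , q) with ∈-map⁻ (0 ∷_) p | ∈-map⁻ incHead q
  ... | w , _ , refl | (y ∷ w′) , _ , ()

length-matching-empty : ∀ {L} (P : Pattern L) n → n < fixedSum P → length (matching P n) ≡ 0
length-matching-empty [] n ()
length-matching-empty (just x ∷ P) n n<Σ with x ≤? n
... | yes x≤n = trans (length-map (x ∷_) (matching P (n ∸ x)))
                  (length-matching-empty P (n ∸ x) (+-cancelˡ-< x _ _ (subst (_< x + fixedSum P) (sym (m+[n∸m]≡n x≤n)) n<Σ)))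
... | no _    = refl
length-matching-empty (nothing ∷ P) zero n<Σ = trans (length-map (0 ∷_) (matching P 0)) (length-matching-empty P 0 n<Σ)
length-matching-empty (nothing ∷ P) (suc n) n<Σ =
  trans (length-++ (map (0 ∷_) (matching P (suc n))))
        (cong₂ _+_ (trans (length-map (0 ∷_) (matching P (suc n))) (length-matching-empty P (suc n) n<Σ))
                   (trans (length-map incHead (matching (nothing ∷ P) n))
                          (length-matching-empty (nothing ∷ P) n (<-trans (n<1+n n) n<Σ))))

LengthMatching : ∀ {L} → Pattern L → Set
LengthMatching P = ∀ n → fixedSum P ≤ n → length (matching P n) ≡ nComp (free P) (n ∸ fixedSum P)

private
  length-matching-just : ∀ {L} x (P : Pattern L) → LengthMatching P → LengthMatching (just x ∷ P)
  length-matching-just x P ih n Σ≤n with x ≤? n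
  ... | yes x≤n = trans (length-map (x ∷_) (matching P (n ∸ x)))
                    (trans (ih (n ∸ x) (≤-trans (≤-reflexive (sym (m+n∸m≡n x (fixedSum P)))) (∸-monoˡ-≤ x Σ≤n)))
                           (cong (nComp (free P)) (∸-+-assoc n x (fixedSum P))))
  ... | no x≰n = ⊥-elim (x≰n (≤-trans (m≤m+n x (fixedSum P)) Σ≤n))

  length-matching-nothing : ∀ {L} (P : Pattern L) → LengthMatching P → LengthMatching (nothing ∷ P)
  length-matching-nothing P ih zero Σ≤0 =
    trans (length-map (0 ∷_) (matching P 0))
          (trans (ih 0 Σ≤0) (trans (cong (nComp (free P)) (0∸n≡0 (fixedSum P)))
                                   (sym (cong (nComp (suc (free P))) (0∸n≡0 (fixedSum P))))))
  length-matching-nothing P ih (suc n) Σ≤n+1 = trans (length-++ (map (0 ∷_) (matching P (suc n))))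
    (trans (cong₂ _+_ (trans (length-map (0 ∷_) (matching P (suc n))) (ih (suc n) Σ≤n+1))
                      (length-map incHead (matching (nothing ∷ P) n)))
           (pascal (fixedSum P ≤? n)))
    where
    pascal : Dec (fixedSum P ≤ n) →
             nComp (free P) (suc n ∸ fixedSum P) + length (matching (nothing ∷ P) n) ≡ nComp (suc (free P)) (suc n ∸ fixedSum P)
    pascal (yes Σ≤n) =
      trans (cong₂ _+_ (cong (nComp (free P)) (+-∸-assoc 1 Σ≤n)) (length-matching-nothing P ih n Σ≤n))
            (sym (cong (nComp (suc (free P))) (+-∸-assoc 1 Σ≤n)))
    pascal (no Σ≰n) =
      trans (cong₂ _+_ (cong (nComp (free P)) (m≤n⇒m∸n≡0 (≰⇒> Σ≰n))) (length-matching-empty (nothing ∷ P) n (≰⇒> Σ≰n)))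
            (trans (+-identityʳ _) (sym (cong (nComp (suc (free P))) (m≤n⇒m∸n≡0 (≰⇒> Σ≰n)))))

length-matching : ∀ {L} (P : Pattern L) → LengthMatching P
length-matching []            zero    _ = refl
length-matching []            (suc n) _ = refl
length-matching (just x ∷ P)  = length-matching-just x P (length-matching P)
length-matching (nothing ∷ P) = length-matching-nothing P (length-matching P)

length-matching-fixedSum≡0 : ∀ {L} (P : Pattern L) n → fixedSum P ≡ 0 → length (matching P n) ≡ nComp (free P) n
length-matching-fixedSum≡0 P n Σ≡0 =
  trans (length-matching P n (≤-trans (≤-reflexive Σ≡0) z≤n)) (cong (λ s → nComp (free P) (n ∸ s)) Σ≡0)

length-matching-≤ : ∀ {L} (P : Pattern L) n {f} → free P ≡ suc f → length (matching P n) ≤ nComp (suc f) n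
length-matching-≤ P n {f} free≡ with fixedSum P ≤? n
... | yes Σ≤n = ≤-trans (≤-reflexive (trans (length-matching P n Σ≤n) (cong (λ l → nComp l (n ∸ fixedSum P)) free≡)))
                        (nComp-mono f (m∸n≤m n (fixedSum P)))
... | no Σ≰n  = ≤-trans (≤-reflexive (length-matching-empty P n (≰⇒> Σ≰n))) z≤n

length-matching-< : ∀ {L} (P : Pattern L) n {f} → free P ≡ suc (suc f) → 1 ≤ fixedSum P → 1 ≤ n →
                    length (matching P n) < nComp (suc (suc f)) n
length-matching-< P n {f} free≡ 1≤Σ 1≤n with fixedSum P ≤? n
... | yes Σ≤n = ≤-trans (s≤s (≤-reflexive (trans (length-matching P n Σ≤n) (cong (λ l → nComp l (n ∸ fixedSum P)) free≡))))
                        (nComp-strictMono f (∸-monoʳ-< {n} {fixedSum P} {0} 1≤Σ Σ≤n))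
... | no Σ≰n  = ≤-trans (s≤s (≤-reflexive (length-matching-empty P n (≰⇒> Σ≰n)))) (nComp-pos (suc f) n)

Unique-length-≤-matching : ∀ {L} (P : Pattern L) n {B : List (Vec ℕ L)} → Unique B →
                           (∀ {b} → b ∈ B → sum b ≡ n × Matches P b) → length B ≤ length (matching P n)
Unique-length-≤-matching P n uB matchingB =
  Unique-length-≤ uB (λ {b} b∈ → matching-complete P n b (proj₁ (matchingB b∈)) (proj₂ (matchingB b∈)))

agreements : ∀ {m} → Vec ℕ m → Vec ℕ m → ℕ
agreements []      []      = 0
agreements (x ∷ a) (y ∷ b) with x ≟ y
... | yes _ = suc (agreements a b)
... | no _  = agreements a b

agreements-comm : ∀ {m} (a b : Vec ℕ m) → agreements a b ≡ agreements b a
agreements-comm []      []      = refl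
agreements-comm (x ∷ a) (y ∷ b) with x ≟ y | y ≟ x
... | yes _    | yes _ = cong suc (agreements-comm a b)
... | no _     | no _  = agreements-comm a b
... | yes refl | no ne = ⊥-elim (ne refl)
... | no ne | yes refl = ⊥-elim (ne refl)

subpatterns : ∀ {m} → Vec ℕ m → List (Pattern m)
subpatterns []      = [] ∷ []
subpatterns (y ∷ b) = map (nothing ∷_) (subpatterns b) ++ map (just y ∷_) (subpatterns b)

length-subpatterns : ∀ {m} (b : Vec ℕ m) → length (subpatterns b) ≡ 2 ^ m
length-subpatterns []              = refl
length-subpatterns {suc m} (y ∷ b) = begin
  length (map (nothing ∷_) (subpatterns b) ++ map (just y ∷_) (subpatterns b))
    ≡⟨ length-++ (map (nothing ∷_) (subpatterns b)) ⟩
  length (map (nothing ∷_) (subpatterns b)) + length (map (just y ∷_) (subpatterns b))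
    ≡⟨ cong₂ _+_ (length-map _ (subpatterns b)) (length-map _ (subpatterns b)) ⟩
  length (subpatterns b) + length (subpatterns b)
    ≡⟨ cong₂ _+_ (length-subpatterns b) (trans (length-subpatterns b) (sym (+-identityʳ (2 ^ m)))) ⟩
  2 ^ m + (2 ^ m + 0) ∎
  where open ≡-Reasoning

Matches⇒∈subpatterns : ∀ {m} (P : Pattern m) (b : Vec ℕ m) → Matches P b → P ∈ subpatterns b
Matches⇒∈subpatterns []            []      _ = here refl
Matches⇒∈subpatterns (nothing ∷ P) (y ∷ b) mb = ∈-++⁺ˡ (∈-map⁺ (nothing ∷_) (Matches⇒∈subpatterns P b mb))
Matches⇒∈subpatterns (just z ∷ P)  (y ∷ b) (refl , mb) =
  ∈-++⁺ʳ (map (nothing ∷_) (subpatterns b)) (∈-map⁺ (just y ∷_) (Matches⇒∈subpatterns P b mb))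

blank : ∀ m → Pattern m
blank m = replicate m nothing

Matches-blank : ∀ {m} (a : Vec ℕ m) → Matches (blank m) a
Matches-blank []      = tt
Matches-blank (x ∷ a) = Matches-blank a

fixed-blank : ∀ m → fixed (blank m) ≡ 0
fixed-blank zero    = refl
fixed-blank (suc m) = fixed-blank m

fixedSum-blank : ∀ m → fixedSum (blank m) ≡ 0
fixedSum-blank zero    = refl
fixedSum-blank (suc m) = fixedSum-blank m

common-pattern : ∀ {m} t (a b : Vec ℕ m) → t ≤ agreements a b →
                 Σ (Pattern m) λ P → fixed P ≡ t × Matches P a × Matches P b
common-pattern {m} zero a b _ = blank m , fixed-blank m , Matches-blank a , Matches-blank b
common-pattern (suc t) [] [] ()
common-pattern (suc t) (x ∷ a) (y ∷ b) t<agr with x ≟ y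
... | yes refl with common-pattern t a b (s≤s⁻¹ t<agr)
...   | P , fixedP , ma , mb = just x ∷ P , cong suc fixedP , (refl , ma) , (refl , mb)
common-pattern (suc t) (x ∷ a) (y ∷ b) t<agr | no _ with common-pattern (suc t) a b t<agr
...   | P , fixedP , ma , mb = nothing ∷ P , fixedP , ma , mb

FreeAgreement : ∀ {m} → Pattern m → Vec ℕ m → Vec ℕ m → Set
FreeAgreement P a b = Σ (Fin _) λ k → lookup P k ≡ nothing × lookup a k ≡ lookup b k

private
  suc-FreeAgreement : ∀ {m} {p : Maybe ℕ} {x y} {P : Pattern m} {a b} → FreeAgreement P a b → FreeAgreement (p ∷ P) (x ∷ a) (y ∷ b)
  suc-FreeAgreement (k , free-k , agree-k) = suc k , free-k , agree-k

larger-pattern-agreement : ∀ {m} (P P′ : Pattern m) (a b : Vec ℕ m) → fixed P < fixed P′ →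
                           Matches P′ a → Matches P′ b → FreeAgreement P a b
larger-pattern-agreement (nothing ∷ P) (just z ∷ P′)  (x ∷ a) (y ∷ b) _ (refl , _) (refl , _) = zero , refl , refl
larger-pattern-agreement (nothing ∷ P) (nothing ∷ P′) (x ∷ a) (y ∷ b) lt ma mb =
  suc-FreeAgreement (larger-pattern-agreement P P′ a b lt ma mb)
larger-pattern-agreement (just w ∷ P) (just z ∷ P′) (x ∷ a) (y ∷ b) lt (_ , ma) (_ , mb) =
  suc-FreeAgreement (larger-pattern-agreement P P′ a b (s≤s⁻¹ lt) ma mb)
larger-pattern-agreement (just w ∷ P) (nothing ∷ P′) (x ∷ a) (y ∷ b) lt ma mb =
  suc-FreeAgreement (larger-pattern-agreement P P′ a b (<-trans (n<1+n _) lt) ma mb)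

mismatch-agreement : ∀ {m} (P P′ : Pattern m) (a b : Vec ℕ m) → Matches P a → ¬ Matches P b →
                     Matches P′ a → Matches P′ b → fixed P ≤ fixed P′ → FreeAgreement P a b
mismatch-agreement [] [] [] [] _ ¬mb _ _ _ = ⊥-elim (¬mb tt)
mismatch-agreement (nothing ∷ P) (just z ∷ P′) (x ∷ a) (y ∷ b) _ _ (refl , _) (refl , _) _ = zero , refl , refl
mismatch-agreement (nothing ∷ P) (nothing ∷ P′) (x ∷ a) (y ∷ b) pa ¬pb ma mb le =
  suc-FreeAgreement (mismatch-agreement P P′ a b pa ¬pb ma mb le)
mismatch-agreement (just w ∷ P) (just z ∷ P′) (x ∷ a) (y ∷ b) (refl , pa) ¬pb (refl , ma) (refl , mb) le =
  suc-FreeAgreement (mismatch-agreement P P′ a b pa (λ pb → ¬pb (refl , pb)) ma mb (s≤s⁻¹ le))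
mismatch-agreement (just w ∷ P) (nothing ∷ P′) (x ∷ a) (y ∷ b) pa ¬pb ma mb le =
  suc-FreeAgreement (larger-pattern-agreement P P′ a b le ma mb)

fixAt : ∀ {m} → Pattern m → Fin m → ℕ → Pattern m
fixAt (p ∷ P) zero    y = just y ∷ P
fixAt (p ∷ P) (suc k) y = p ∷ fixAt P k y

fixed-fixAt : ∀ {m} (P : Pattern m) k y → lookup P k ≡ nothing → fixed (fixAt P k y) ≡ suc (fixed P)
fixed-fixAt (nothing ∷ P) zero    y _ = refl
fixed-fixAt (nothing ∷ P) (suc k) y e = fixed-fixAt P k y e
fixed-fixAt (just z ∷ P)  (suc k) y e = cong suc (fixed-fixAt P k y e)

Matches-fixAt : ∀ {m} (P : Pattern m) k (a : Vec ℕ m) → Matches P a → Matches (fixAt P k (lookup a k)) a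
Matches-fixAt (nothing ∷ P) zero    (x ∷ a) ma        = refl , ma
Matches-fixAt (just z ∷ P)  zero    (x ∷ a) (_ , ma)  = refl , ma
Matches-fixAt (nothing ∷ P) (suc k) (x ∷ a) ma        = Matches-fixAt P k a ma
Matches-fixAt (just z ∷ P)  (suc k) (x ∷ a) (e , ma)  = e , Matches-fixAt P k a ma

zeroPattern : ∀ {m} → Subset m → Pattern m
zeroPattern []            = []
zeroPattern (inside ∷ T)  = just 0 ∷ zeroPattern T
zeroPattern (outside ∷ T) = nothing ∷ zeroPattern T

fixed-zeroPattern : ∀ {m} (T : Subset m) → fixed (zeroPattern T) ≡ ∣ T ∣
fixed-zeroPattern []            = refl
fixed-zeroPattern (inside ∷ T)  = cong suc (fixed-zeroPattern T)
fixed-zeroPattern (outside ∷ T) = fixed-zeroPattern T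

fixedSum-zeroPattern : ∀ {m} (T : Subset m) → fixedSum (zeroPattern T) ≡ 0
fixedSum-zeroPattern []            = refl
fixedSum-zeroPattern (inside ∷ T)  = fixedSum-zeroPattern T
fixedSum-zeroPattern (outside ∷ T) = fixedSum-zeroPattern T

Matches-zeroPattern⇒ : ∀ {m} (T : Subset m) (a : Vec ℕ m) → Matches (zeroPattern T) a → ∀ i → i ∈ₛ T → lookup a i ≡ 0
Matches-zeroPattern⇒ (inside ∷ T)  (x ∷ a) (x≡0 , ma) zero    here      = x≡0
Matches-zeroPattern⇒ (inside ∷ T)  (x ∷ a) (_ , ma)   (suc i) (there p) = Matches-zeroPattern⇒ T a ma i p
Matches-zeroPattern⇒ (outside ∷ T) (x ∷ a) ma         (suc i) (there p) = Matches-zeroPattern⇒ T a ma i p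

Matches-zeroPattern⇐ : ∀ {m} (T : Subset m) (a : Vec ℕ m) → (∀ i → i ∈ₛ T → lookup a i ≡ 0) → Matches (zeroPattern T) a
Matches-zeroPattern⇐ []            []      _     = tt
Matches-zeroPattern⇐ (inside ∷ T)  (x ∷ a) zeros = zeros zero here , Matches-zeroPattern⇐ T a (λ i p → zeros (suc i) (there p))
Matches-zeroPattern⇐ (outside ∷ T) (x ∷ a) zeros = Matches-zeroPattern⇐ T a (λ i p → zeros (suc i) (there p))

support : ∀ {m} → Pattern m → Subset m
support []            = []
support (nothing ∷ P) = outside ∷ support P
support (just _ ∷ P)  = inside ∷ support P

zeroPattern-support : ∀ {m} (P : Pattern m) → fixedSum P ≡ 0 → zeroPattern (support P) ≡ P
zeroPattern-support []             _  = refl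
zeroPattern-support (nothing ∷ P)  Σ≡0 = cong (nothing ∷_) (zeroPattern-support P Σ≡0)
zeroPattern-support (just zero ∷ P) Σ≡0 = cong (just 0 ∷_) (zeroPattern-support P Σ≡0)

restrict : ∀ {m L} → m ≤ L → Vec ℕ L → Vec ℕ m
restrict {zero}              _   _       = []
restrict {suc m} {suc L} m≤L (x ∷ u) = x ∷ restrict (s≤s⁻¹ m≤L) u

extend : ∀ {m L} → m ≤ L → Pattern m → Pattern L
extend {zero}  {L}     _   []      = blank L
extend {suc m} {suc L} m≤L (p ∷ P) = p ∷ extend (s≤s⁻¹ m≤L) P

Matches-extend⇒ : ∀ {m L} (m≤L : m ≤ L) (P : Pattern m) (u : Vec ℕ L) → Matches (extend m≤L P) u → Matches P (restrict m≤L u)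
Matches-extend⇒ {m = zero}  {L}     _   []            u       _          = tt
Matches-extend⇒ {m = suc m} {suc L} m≤L (nothing ∷ P) (x ∷ u) mu         = Matches-extend⇒ (s≤s⁻¹ m≤L) P u mu
Matches-extend⇒ {m = suc m} {suc L} m≤L (just y ∷ P)  (x ∷ u) (x≡y , mu) = x≡y , Matches-extend⇒ (s≤s⁻¹ m≤L) P u mu

Matches-extend⇐ : ∀ {m L} (m≤L : m ≤ L) (P : Pattern m) (u : Vec ℕ L) → Matches P (restrict m≤L u) → Matches (extend m≤L P) u
Matches-extend⇐ {m = zero}  {L}     _   []            u       _          = Matches-blank u
Matches-extend⇐ {m = suc m} {suc L} m≤L (nothing ∷ P) (x ∷ u) mu         = Matches-extend⇐ (s≤s⁻¹ m≤L) P u mu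
Matches-extend⇐ {m = suc m} {suc L} m≤L (just y ∷ P)  (x ∷ u) (x≡y , mu) = x≡y , Matches-extend⇐ (s≤s⁻¹ m≤L) P u mu

fixed-extend : ∀ {m L} (m≤L : m ≤ L) (P : Pattern m) → fixed (extend m≤L P) ≡ fixed P
fixed-extend {m = zero}  {L}     _   []            = fixed-blank L
fixed-extend {m = suc m} {suc L} m≤L (nothing ∷ P) = fixed-extend (s≤s⁻¹ m≤L) P
fixed-extend {m = suc m} {suc L} m≤L (just y ∷ P)  = cong suc (fixed-extend (s≤s⁻¹ m≤L) P)

fixedSum-extend : ∀ {m L} (m≤L : m ≤ L) (P : Pattern m) → fixedSum (extend m≤L P) ≡ fixedSum P
fixedSum-extend {m = zero}  {L}     _   []            = fixedSum-blank L
fixedSum-extend {m = suc m} {suc L} m≤L (nothing ∷ P) = fixedSum-extend (s≤s⁻¹ m≤L) P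
fixedSum-extend {m = suc m} {suc L} m≤L (just y ∷ P)  = cong (y +_) (fixedSum-extend (s≤s⁻¹ m≤L) P)

lookup-inject≤ : ∀ {m L} (m≤L : m ≤ L) (u : Vec ℕ L) (i : Fin m) → lookup u (inject≤ i m≤L) ≡ lookup (restrict m≤L u) i
lookup-inject≤ {m = suc m} {suc L} m≤L (x ∷ u) zero    = refl
lookup-inject≤ {m = suc m} {suc L} m≤L (x ∷ u) (suc i) = lookup-inject≤ (s≤s⁻¹ m≤L) u i

agree-restrict : ∀ {l1 l2} (p₁ : l1 ⊓ l2 ≤ l1) (p₂ : l1 ⊓ l2 ≤ l2) (u : Vec ℕ l1) (v : Vec ℕ l2) →
                 agree u v ≡ agreements (restrict p₁ u) (restrict p₂ v)
agree-restrict {zero}           p₁ p₂ []      v       = refl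
agree-restrict {suc l1} {zero}  p₁ p₂ (x ∷ u) []      = refl
agree-restrict {suc l1} {suc l2} p₁ p₂ (x ∷ u) (y ∷ v) with x ≟ y
... | yes x≡y = trans (cong length (filter-accept (λ p → proj₁ p ≟ proj₂ p) {x , y} {zip (toList u) (toList v)} x≡y))
                      (cong suc (agree-restrict (s≤s⁻¹ p₁) (s≤s⁻¹ p₂) u v))
... | no x≢y  = trans (cong length (filter-reject (λ p → proj₁ p ≟ proj₂ p) {x , y} {zip (toList u) (toList v)} x≢y))
                      (agree-restrict (s≤s⁻¹ p₁) (s≤s⁻¹ p₂) u v)

subpatternsOfSize : ∀ {m} → ℕ → Vec ℕ m → List (Pattern m)
subpatternsOfSize t w = filter (λ P → fixed P ≟ t) (subpatterns w)

length-subpatternsOfSize : ∀ {m} t (w : Vec ℕ m) → length (subpatternsOfSize t w) ≤ 2 ^ m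
length-subpatternsOfSize t w = ≤-trans (length-filter (λ P → fixed P ≟ t) (subpatterns w)) (≤-reflexive (length-subpatterns w))

fixed-∈subpatternsOfSize : ∀ {m} {t} {w : Vec ℕ m} {P} → P ∈ subpatternsOfSize t w → fixed P ≡ t
fixed-∈subpatternsOfSize {t = t} {w} P∈ = proj₂ (∈-filter⁻ (λ P → fixed P ≟ t) {xs = subpatterns w} P∈)

StarBoundVia : ∀ {m} {X : Set} → (X → Vec ℕ m) → List X → ℕ → ℕ → Set₁
StarBoundVia {m} {X} r B s N = ∀ (Q : Pattern m) → fixed Q ≡ s → ∀ {R : X → Set} (R? : Decidable R) →
                               (∀ {b} → R b → Matches Q (r b)) → length (filter R? B) ≤ N

module Kernel {m : ℕ} {X Y : Set} (rX : X → Vec ℕ m) (rY : Y → Vec ℕ m) where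

  inStar : Pattern m → List X → List X
  inStar P B = filter (λ b → matches? P (rX b)) B

  StarBound : List X → ℕ → ℕ → Set₁
  StarBound = StarBoundVia rX

  length-≤-sum-inStar : ∀ t (c : Y) (B : List X) → (∀ {b} → b ∈ B → t ≤ agreements (rX b) (rY c)) →
                        length B ≤ sumᴸ (map (λ P → length (inStar P B)) (subpatternsOfSize t (rY c)))
  length-≤-sum-inStar t c B agreesWith-c = length-≤-sum-filter (subpatternsOfSize t (rY c)) (λ P b → matches? P (rX b)) B
    λ {b} b∈ → let (P , fixedP , mb , mc) = common-pattern t (rX b) (rY c) (agreesWith-c b∈)
               in P , ∈-filter⁺ (λ P → fixed P ≟ t) (Matches⇒∈subpatterns P (rY c) mc) fixedP , mb

  length-≤-2^m* : ∀ t (c : Y) (B : List X) {N} → (∀ {b} → b ∈ B → t ≤ agreements (rX b) (rY c)) →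
                  (∀ {P} → P ∈ subpatternsOfSize t (rY c) → length (inStar P B) ≤ N) → length B ≤ 2 ^ m * N
  length-≤-2^m* t c B {N} agreesWith-c small = begin
    length B
      ≤⟨ length-≤-sum-inStar t c B agreesWith-c ⟩
    sumᴸ (map (λ P → length (inStar P B)) (subpatternsOfSize t (rY c)))
      ≤⟨ sum-map-≤-length* (subpatternsOfSize t (rY c)) small ⟩
    length (subpatternsOfSize t (rY c)) * N
      ≤⟨ *-monoˡ-≤ N (length-subpatternsOfSize t (rY c)) ⟩
    2 ^ m * N ∎
    where open ≤-Reasoning

  StarBound⇒length-inStar-≤ : ∀ {t} (c : Y) (B : List X) {N} → StarBound B t N →
                              ∀ {P} → P ∈ subpatternsOfSize t (rY c) → length (inStar P B) ≤ N
  StarBound⇒length-inStar-≤ c B bound {P} P∈ = bound P (fixed-∈subpatternsOfSize {w = rY c} P∈) (λ b → matches? P (rX b)) (λ mb → mb)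

  -- If c missed the t-pattern P shared by all of B, every b ∈ B would also agree with c at one of the
  -- m coordinates left free by P; each of these m stars with t + 1 prescribed coordinates holds at
  -- most N members of B.
  kernel : ∀ t (P : Pattern m) → fixed P ≡ t → (B : List X) → (∀ {b} → b ∈ B → Matches P (rX b)) →
           ∀ {N} → StarBound B (suc t) N → m * N < length B →
           ∀ (c : Y) → (∀ {b} → b ∈ B → t ≤ agreements (rX b) (rY c)) → Matches P (rY c)
  kernel t P fixedP B allMatch {N} bound large c agreesWith-c with matches? P (rY c)
  ... | yes mc = mc
  ... | no ¬mc = contradiction large (≤⇒≯ (begin
    length B
      ≤⟨ length-≤-sum-filter (allFin m) R? B (λ {b} b∈ → covered b∈) ⟩
    sumᴸ (map (λ k → length (filter (R? k) B)) (allFin m))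
      ≤⟨ sum-map-≤-length* (allFin m) (λ {k} _ → perCoordinate k (decFree k)) ⟩
    length (allFin m) * N
      ≡⟨ cong (_* N) (length-tabulate {n = m} (λ i → i)) ⟩
    m * N ∎))
    where
    open ≤-Reasoning
    w : Vec ℕ m
    w = rY c
    decFree : ∀ k → Dec (lookup P k ≡ nothing)
    decFree k with lookup P k
    ... | nothing = yes refl
    ... | just _  = no (λ ())
    R : Fin m → X → Set
    R k b = lookup P k ≡ nothing × Matches (fixAt P k (lookup w k)) (rX b)
    R? : ∀ k → Decidable (R k)
    R? k b = decFree k ×-dec matches? (fixAt P k (lookup w k)) (rX b)
    covered : ∀ {b} → b ∈ B → Σ (Fin m) λ k → k ∈ allFin m × R k b
    covered {b} b∈ with common-pattern t (rX b) w (agreesWith-c b∈)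
    ... | P′ , fixedP′ , mb , mc with mismatch-agreement P P′ (rX b) w (allMatch b∈) ¬mc mb mc (≤-reflexive (trans fixedP (sym fixedP′)))
    ... | k , free-k , agree-k = k , ∈-allFin k , free-k , subst (λ y → Matches (fixAt P k y) (rX b)) agree-k (Matches-fixAt P k (rX b) (allMatch b∈))
    perCoordinate : ∀ k → Dec (lookup P k ≡ nothing) → length (filter (R? k) B) ≤ N
    perCoordinate k (yes free-k) = bound (fixAt P k (lookup w k)) (trans (fixed-fixAt P k (lookup w k) free-k) (cong suc fixedP)) (R? k) proj₂
    perCoordinate k (no fixed-k) = subst (λ xs → length xs ≤ N) (sym (filter-none (R? k) (All.tabulate {xs = B} (λ _ → fixed-k ∘ proj₁)))) z≤n

module Stars {m L : ℕ} (m≤L : m ≤ L) where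

  ι : Fin m → Fin L
  ι i = inject≤ i m≤L

  free-extend : ∀ (P : Pattern m) {s k} → fixed P ≡ s → L ≡ k + s → free (extend m≤L P) ≡ k
  free-extend P {s} {k} fixedP L≡ = +-cancelʳ-≡ s (free (extend m≤L P)) k (begin
    free (extend m≤L P) + s                    ≡⟨ cong (free (extend m≤L P) +_) (sym (trans (fixed-extend m≤L P) fixedP)) ⟩
    free (extend m≤L P) + fixed (extend m≤L P) ≡⟨ free+fixed (extend m≤L P) ⟩
    L                                          ≡⟨ L≡ ⟩
    k + s ∎)
    where open ≡-Reasoning

  A⊆matching : ∀ n {A : List (Vec ℕ L)} → (∀ {b} → b ∈ A → sum b ≡ n) →
               ∀ (P : Pattern m) → (∀ {b} → b ∈ A → Matches P (restrict m≤L b)) → A ⊆ matching (extend m≤L P) n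
  A⊆matching n sums P allMatch {b} b∈ = matching-complete (extend m≤L P) n b (sums b∈) (Matches-extend⇐ m≤L P b (allMatch b∈))

  starBound : ∀ n {A : List (Vec ℕ L)} → Unique A → (∀ {b} → b ∈ A → sum b ≡ n) →
              ∀ {s f} → L ≡ suc f + s → StarBoundVia (restrict m≤L) A s (nComp (suc f) n)
  starBound n {A} uA sums L≡ Q fixedQ R? RinStar = ≤-trans
    (Unique-length-≤-matching (extend m≤L Q) n (Unique.filter⁺ R? uA)
      (λ b∈ → let (b∈A , Rb) = ∈-filter⁻ R? {xs = A} b∈
              in sums b∈A , Matches-extend⇐ m≤L Q _ (RinStar Rb)))
    (length-matching-≤ (extend m≤L Q) n (free-extend Q fixedQ L≡))

  zeroStar : Subset m → ℕ → List (Vec ℕ L)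
  zeroStar T n = matching (extend m≤L (zeroPattern T)) n

  ZeroOn : Subset m → Vec ℕ L → Set
  ZeroOn T v = ∀ i → i ∈ₛ T → lookup v (ι i) ≡ 0

  ∈-zeroStar⁺ : ∀ T n {v} → sum v ≡ n → ZeroOn T v → v ∈ zeroStar T n
  ∈-zeroStar⁺ T n {v} Σv zeros = matching-complete (extend m≤L (zeroPattern T)) n v Σv
    (Matches-extend⇐ m≤L _ v (Matches-zeroPattern⇐ T (restrict m≤L v) (λ i i∈ → trans (sym (lookup-inject≤ m≤L v i)) (zeros i i∈))))

  ∈-zeroStar⁻ : ∀ T n {v} → v ∈ zeroStar T n → sum v ≡ n × ZeroOn T v
  ∈-zeroStar⁻ T n {v} v∈ with matching-sound (extend m≤L (zeroPattern T)) n v∈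
  ... | Σv , mv = Σv , λ i i∈ → trans (lookup-inject≤ m≤L v i) (Matches-zeroPattern⇒ T (restrict m≤L v) (Matches-extend⇒ m≤L _ v mv) i i∈)

  IsStar⇒⊆ : ∀ n T {A} → IsStar n ι T A → A ⊆ zeroStar T n
  IsStar⇒⊆ n T star {v} v∈ = let (Σv , zeros) = Equivalence.to (star v) v∈ in ∈-zeroStar⁺ T n Σv zeros

  IsStar⇒⊇ : ∀ n T {A} → IsStar n ι T A → zeroStar T n ⊆ A
  IsStar⇒⊇ n T star {v} v∈ = Equivalence.from (star v) (∈-zeroStar⁻ T n v∈)

  ⊆-⊇⇒IsStar : ∀ n T {A} → A ⊆ zeroStar T n → zeroStar T n ⊆ A → IsStar n ι T A
  ⊆-⊇⇒IsStar n T A⊆ ⊇A v = mk⇔ (∈-zeroStar⁻ T n ∘ A⊆) (λ (Σv , zeros) → ⊇A (∈-zeroStar⁺ T n Σv zeros))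

  module _ {t g : ℕ} (L≡ : L ≡ suc (suc g) + t) where

    length-zeroStar : ∀ (T : Subset m) n → ∣ T ∣ ≡ t → length (zeroStar T n) ≡ nComp (suc (suc g)) n
    length-zeroStar T n ∣T∣≡t = trans
      (length-matching-fixedSum≡0 (extend m≤L (zeroPattern T)) n (trans (fixedSum-extend m≤L (zeroPattern T)) (fixedSum-zeroPattern T)))
      (cong (λ l → nComp l n) (free-extend (zeroPattern T) (trans (fixed-zeroPattern T) ∣T∣≡t) L≡))

    length-IsStar : ∀ n (T : Subset m) {A} → ∣ T ∣ ≡ t → Unique A → IsStar n ι T A → length A ≡ nComp (suc (suc g)) n
    length-IsStar n T {A} ∣T∣≡t uA star = trans
      (≤-antisym (Unique-length-≤ uA (IsStar⇒⊆ n T star))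
                 (Unique-length-≤ (matching-unique (extend m≤L (zeroPattern T)) n) (IsStar⇒⊇ n T star)))
      (length-zeroStar T n ∣T∣≡t)

    module _ (n : ℕ) {A : List (Vec ℕ L)} (uA : Unique A) (sums : ∀ {b} → b ∈ A → sum b ≡ n)
             (P : Pattern m) (fixedP : fixed P ≡ t) (allMatch : ∀ {b} → b ∈ A → Matches P (restrict m≤L b)) where

      length-≤-star : length A ≤ nComp (suc (suc g)) n
      length-≤-star = ≤-trans (Unique-length-≤ uA (A⊆matching n sums P allMatch))
                              (length-matching-≤ (extend m≤L P) n (free-extend P fixedP L≡))

      fixedSum≡0 : 1 ≤ n → length A ≡ nComp (suc (suc g)) n → fixedSum P ≡ 0
      fixedSum≡0 1≤n |A|≡ with fixedSum P in Σ≡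
      ... | zero  = refl
      ... | suc _ = contradiction
        (≤-trans (≤-reflexive (sym |A|≡)) (Unique-length-≤ uA (A⊆matching n sums P allMatch)))
        (<⇒≱ (length-matching-< (extend m≤L P) n (free-extend P fixedP L≡)
                                (≤-trans (s≤s z≤n) (≤-reflexive (sym (trans (fixedSum-extend m≤L P) Σ≡)))) 1≤n))

      IsStar-support : 1 ≤ n → length A ≡ nComp (suc (suc g)) n → ∣ support P ∣ ≡ t × IsStar n ι (support P) A
      IsStar-support 1≤n |A|≡ = ∣support∣≡t , ⊆-⊇⇒IsStar n (support P) A⊆ (Unique-⊆-length-≥⇒⊇ (≡-dec _≟_) uA A⊆ |star|≤|A|)
        where
        P≡ : zeroPattern (support P) ≡ P
        P≡ = zeroPattern-support P (fixedSum≡0 1≤n |A|≡)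
        ∣support∣≡t : ∣ support P ∣ ≡ t
        ∣support∣≡t = trans (sym (fixed-zeroPattern (support P))) (trans (cong fixed P≡) fixedP)
        A⊆ : A ⊆ zeroStar (support P) n
        A⊆ = subst (λ Q → A ⊆ matching (extend m≤L Q) n) (sym P≡) (A⊆matching n sums P allMatch)
        |star|≤|A| : length (zeroStar (support P) n) ≤ length A
        |star|≤|A| = ≤-reflexive (trans (length-zeroStar (support P) n ∣support∣≡t) (sym |A|≡))

*-≡-bounds⇒≡ : ∀ {a b M N} → a ≤ M → b ≤ N → 1 ≤ M → 1 ≤ N → a * b ≡ M * N → a ≡ M × b ≡ N
*-≡-bounds⇒≡ {a} {b} {M} {N} a≤M b≤N 1≤M 1≤N ab≡MN with m≤n⇒m<n∨m≡n a≤M | m≤n⇒m<n∨m≡n b≤N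
... | right a≡M | right b≡N = a≡M , b≡N
... | left a<M  | _         = contradiction ab≡MN (<⇒≢ (≤-<-trans (*-monoʳ-≤ a b≤N) (*-monoˡ-< N {{>-nonZero 1≤N}} a<M)))
... | _         | left b<N  = contradiction ab≡MN (<⇒≢ (≤-<-trans (*-monoˡ-≤ b a≤M) (*-monoʳ-< M {{>-nonZero 1≤M}} b<N)))

module TwoFamilies {l1 l2 t g1 g2 : ℕ} (l1≡ : l1 ≡ suc (suc g1) + t) (l2≡ : l2 ≡ suc (suc g2) + t)
                   {n1 n2 : ℕ} {A1 : List (Vec ℕ l1)} {A2 : List (Vec ℕ l2)}
                   (F1 : IsFamily n1 A1) (F2 : IsFamily n2 A2) (cross : CrossInt t A1 A2) where

  m : ℕ
  m = l1 ⊓ l2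
  p₁ : m ≤ l1
  p₁ = m⊓n≤m l1 l2
  p₂ : m ≤ l2
  p₂ = m⊓n≤n l1 l2
  r₁ : Vec ℕ l1 → Vec ℕ m
  r₁ = restrict p₁
  r₂ : Vec ℕ l2 → Vec ℕ m
  r₂ = restrict p₂
  module S₁ = Stars p₁
  module S₂ = Stars p₂
  module K₁ = Kernel r₁ r₂
  module K₂ = Kernel r₂ r₁

  M₁ M₂ N₁ N₂ : ℕ
  M₁ = nComp (suc (suc g1)) n1
  M₂ = nComp (suc (suc g2)) n2
  N₁ = nComp (suc g1) n1
  N₂ = nComp (suc g2) n2

  U₁ : Unique A1
  U₁ = proj₁ F1
  U₂ : Unique A2
  U₂ = proj₁ F2
  sums₁ : ∀ {b} → b ∈ A1 → sum b ≡ n1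
  sums₁ = All.lookup (proj₂ F1)
  sums₂ : ∀ {c} → c ∈ A2 → sum c ≡ n2
  sums₂ = All.lookup (proj₂ F2)

  cross₁₂ : ∀ {b c} → b ∈ A1 → c ∈ A2 → t ≤ agreements (r₁ b) (r₂ c)
  cross₁₂ {b} {c} b∈ c∈ = subst (t ≤_) (agree-restrict p₁ p₂ b c) (cross b c b∈ c∈)
  cross₂₁ : ∀ {c b} → c ∈ A2 → b ∈ A1 → t ≤ agreements (r₂ c) (r₁ b)
  cross₂₁ {c} {b} c∈ b∈ = subst (t ≤_) (agreements-comm (r₁ b) (r₂ c)) (cross₁₂ b∈ c∈)

  l1≡′ : l1 ≡ suc g1 + suc t
  l1≡′ = trans l1≡ (sym (+-suc (suc g1) t))
  l2≡′ : l2 ≡ suc g2 + suc t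
  l2≡′ = trans l2≡ (sym (+-suc (suc g2) t))

  |A1|≤ : ∀ {c} → c ∈ A2 → length A1 ≤ 2 ^ m * M₁
  |A1|≤ {c} c∈ = K₁.length-≤-2^m* t c A1 (λ b∈ → cross₁₂ b∈ c∈)
                   (K₁.StarBound⇒length-inStar-≤ c A1 (S₁.starBound n1 U₁ sums₁ l1≡))
  |A2|≤ : ∀ {b} → b ∈ A1 → length A2 ≤ 2 ^ m * M₂
  |A2|≤ {b} b∈ = K₂.length-≤-2^m* t b A2 (λ c∈ → cross₂₁ c∈ b∈)
                   (K₂.StarBound⇒length-inStar-≤ b A2 (S₂.starBound n2 U₂ sums₂ l2≡))

  SharedPattern : Set
  SharedPattern = Σ (Pattern m) λ P → fixed P ≡ t × (∀ {b} → b ∈ A1 → Matches P (r₁ b)) × (∀ {c} → c ∈ A2 → Matches P (r₂ c))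

  -- Either some t-star around an element of A2 contains many members of A1, and then the kernel
  -- argument run in both directions yields a common t-pattern, or A1 (or A2) is small.
  trichotomy : length A1 ≤ 2 ^ m * (m * N₁) ⊎ length A2 ≤ m * N₂ ⊎ SharedPattern
  trichotomy with empty-or-∈ A2
  ... | left A2≡[] = right (left (subst (λ xs → length xs ≤ m * N₂) (sym A2≡[]) z≤n))
  ... | right (v , v∈A2) with exists-or-all-≤ (λ P → length (K₁.inStar P A1)) (m * N₁) (subpatternsOfSize t (r₂ v))
  ...   | right allSmall = left (K₁.length-≤-2^m* t v A1 (λ b∈ → cross₁₂ b∈ v∈A2) allSmall)
  ...   | left (P , P∈ , large) with m * N₂ <? length A2
  ...     | no A2-small = right (left (≮⇒≥ A2-small))
  ...     | yes A2-large = right (right (P , fixedP , allA1 , allA2))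
    where
    fixedP : fixed P ≡ t
    fixedP = fixed-∈subpatternsOfSize {w = r₂ v} P∈
    F : List (Vec ℕ l1)
    F = K₁.inStar P A1
    F-sub : ∀ {b} → b ∈ F → b ∈ A1 × Matches P (r₁ b)
    F-sub = ∈-filter⁻ (λ b → matches? P (r₁ b)) {xs = A1}
    allA2 : ∀ {c} → c ∈ A2 → Matches P (r₂ c)
    allA2 {c} c∈ = K₁.kernel t P fixedP F (proj₂ ∘ F-sub)
      (S₁.starBound n1 (Unique.filter⁺ (λ b → matches? P (r₁ b)) U₁) (sums₁ ∘ proj₁ ∘ F-sub) l1≡′) large
      c (λ b∈ → cross₁₂ (proj₁ (F-sub b∈)) c∈)
    allA1 : ∀ {b} → b ∈ A1 → Matches P (r₁ b)
    allA1 {b} b∈ = K₂.kernel t P fixedP A2 allA2 (S₂.starBound n2 U₂ sums₂ l2≡′) A2-large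
      b (λ c∈ → cross₂₁ c∈ b∈)

  Extremal : Set
  Extremal = ∃[ T ] (∣ T ∣ ≡ t × IsStar n1 (inj₁ {l1} {l2}) T A1 × IsStar n2 (inj₂ {l1} {l2}) T A2)

  Conclusion : Set
  Conclusion = (length A1 * length A2 ≤ M₁ * M₂) × (length A1 * length A2 ≡ M₁ * M₂ → Extremal)

  private
    regroup : ∀ x y z → x * (y * z) ≡ (y * x) * z
    regroup x y z = trans (sym (*-assoc x y z)) (cong (_* z) (*-comm x y))

    <⇒Conclusion : length A1 * length A2 < M₁ * M₂ → Conclusion
    <⇒Conclusion lt = <⇒≤ lt , λ eq → contradiction eq (<⇒≢ lt)

  small₁⇒Conclusion : 2 ^ m * (2 ^ m * (m * N₁)) < M₁ → length A1 ≤ 2 ^ m * (m * N₁) → Conclusion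
  small₁⇒Conclusion M₁-large A1-small = <⇒Conclusion (begin-strict
    length A1 * length A2          ≤⟨ length-*-mono-≤ A1 |A2|≤ ⟩
    length A1 * (2 ^ m * M₂)       ≤⟨ *-monoˡ-≤ (2 ^ m * M₂) A1-small ⟩
    2 ^ m * (m * N₁) * (2 ^ m * M₂) ≡⟨ regroup (2 ^ m * (m * N₁)) (2 ^ m) M₂ ⟩
    2 ^ m * (2 ^ m * (m * N₁)) * M₂ <⟨ *-monoˡ-< M₂ {{>-nonZero (nComp-pos (suc g2) n2)}} M₁-large ⟩
    M₁ * M₂                        ∎)
    where open ≤-Reasoning

  small₂⇒Conclusion : 2 ^ m * (m * N₂) < M₂ → length A2 ≤ m * N₂ → Conclusion
  small₂⇒Conclusion M₂-large A2-small = <⇒Conclusion (begin-strict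
    length A1 * length A2    ≡⟨ *-comm (length A1) (length A2) ⟩
    length A2 * length A1    ≤⟨ length-*-mono-≤ A2 |A1|≤ ⟩
    length A2 * (2 ^ m * M₁) ≤⟨ *-monoˡ-≤ (2 ^ m * M₁) A2-small ⟩
    m * N₂ * (2 ^ m * M₁)    ≡⟨ regroup (m * N₂) (2 ^ m) M₁ ⟩
    2 ^ m * (m * N₂) * M₁    <⟨ *-monoˡ-< M₁ {{>-nonZero (nComp-pos (suc g1) n1)}} M₂-large ⟩
    M₂ * M₁                  ≡⟨ *-comm M₂ M₁ ⟩
    M₁ * M₂                  ∎)
    where open ≤-Reasoning

  shared⇒Conclusion : 1 ≤ n1 → 1 ≤ n2 → SharedPattern → Conclusion
  shared⇒Conclusion 1≤n1 1≤n2 (P , fixedP , allA1 , allA2) = *-mono-≤ |A1|≤M₁ |A2|≤M₂ , extremal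
    where
    |A1|≤M₁ : length A1 ≤ M₁
    |A1|≤M₁ = S₁.length-≤-star l1≡ n1 U₁ sums₁ P fixedP allA1
    |A2|≤M₂ : length A2 ≤ M₂
    |A2|≤M₂ = S₂.length-≤-star l2≡ n2 U₂ sums₂ P fixedP allA2
    extremal : length A1 * length A2 ≡ M₁ * M₂ → Extremal
    extremal eq with *-≡-bounds⇒≡ |A1|≤M₁ |A2|≤M₂ (nComp-pos (suc g1) n1) (nComp-pos (suc g2) n2) eq
    ... | |A1|≡M₁ , |A2|≡M₂ with S₁.IsStar-support l1≡ n1 U₁ sums₁ P fixedP allA1 1≤n1 |A1|≡M₁
                               | S₂.IsStar-support l2≡ n2 U₂ sums₂ P fixedP allA2 1≤n2 |A2|≡M₂
    ...   | ∣T∣≡t , star₁ | _ , star₂ = support P , ∣T∣≡t , star₁ , star₂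

  conclusion : 1 ≤ n1 → 1 ≤ n2 → 2 ^ m * (2 ^ m * m) * suc g1 ≤ n1 → 2 ^ m * m * suc g2 ≤ n2 → Conclusion
  conclusion 1≤n1 1≤n2 n1-large n2-large with trichotomy
  ... | left A1-small          = small₁⇒Conclusion M₁-large A1-small
    where
    M₁-large : 2 ^ m * (2 ^ m * (m * N₁)) < M₁
    M₁-large = subst (_< M₁) (trans (*-assoc (2 ^ m) (2 ^ m * m) N₁) (cong (2 ^ m *_) (*-assoc (2 ^ m) m N₁)))
                     (nComp-ratio (2 ^ m * (2 ^ m * m)) g1 n1 n1-large)
  ... | right (left A2-small)  = small₂⇒Conclusion M₂-large A2-small
    where
    M₂-large : 2 ^ m * (m * N₂) < M₂
    M₂-large = subst (_< M₂) (*-assoc (2 ^ m) m N₂) (nComp-ratio (2 ^ m * m) g2 n2 n2-large)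
  ... | right (right shared)   = shared⇒Conclusion 1≤n1 1≤n2 shared

  Extremal⇒≡ : Extremal → length A1 * length A2 ≡ M₁ * M₂
  Extremal⇒≡ (T , ∣T∣≡t , star₁ , star₂) =
    cong₂ _*_ (S₁.length-IsStar l1≡ n1 T ∣T∣≡t U₁ star₁) (S₂.length-IsStar l2≡ n2 T ∣T∣≡t U₂ star₂)

split-length : ∀ {l t} → t + 2 ≤ l → Σ ℕ λ g → l ≡ suc (suc g) + t
split-length {l} {t} t+2≤l with m≤n⇒∃[o]m+o≡n t+2≤l
... | o , t+2+o≡l = o , trans (sym t+2+o≡l) (trans (+-assoc t 2 o) (+-comm t (2 + o)))

binomial≡nComp : ∀ {l t g} n → l ≡ suc (suc g) + t → (n + l ∸ t ∸ 1) C (l ∸ t ∸ 1) ≡ nComp (suc (suc g)) n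
binomial≡nComp {t = t} {g} n refl = trans (cong₂ _C_ top bottom) (sym (nComp≡C (suc g) n))
  where
  bottom : suc (suc g) + t ∸ t ∸ 1 ≡ suc g
  bottom = cong (_∸ 1) (m+n∸n≡m (suc (suc g)) t)
  top : n + (suc (suc g) + t) ∸ t ∸ 1 ≡ n + suc g
  top = trans (cong (λ k → k ∸ t ∸ 1) (sym (+-assoc n (suc (suc g)) t)))
              (trans (cong (_∸ 1) (m+n∸n≡m (n + suc (suc g)) t)) (cong (_∸ 1) (+-suc n (suc g))))

split-length⇒suc≤ : ∀ {l t g} → l ≡ suc (suc g) + t → suc g ≤ l
split-length⇒suc≤ {t = t} {g} refl = ≤-trans (n≤1+n (suc g)) (m≤m+n (suc (suc g)) t)

*-≤-threshold : ∀ {a b K L n} → a ≤ K → b ≤ L → suc (K * L) ≤ n → a * b ≤ n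
*-≤-threshold a≤K b≤L KL<n = ≤-trans (*-mono-≤ a≤K b≤L) (<⇒≤ KL<n)

theorem2p1 : (l1 l2 t : ℕ) → 1 ≤ l1 → 1 ≤ l2 → 1 ≤ t → t + 2 ≤ l1 ⊓ l2 →
    ∃[ n0 ] ∀ (n1 n2 : ℕ) → n0 ≤ n1 → n0 ≤ n2 →
    ∀ (A1 : List (Vec ℕ l1)) (A2 : List (Vec ℕ l2)) →
    IsFamily n1 A1 → IsFamily n2 A2 → CrossInt t A1 A2 →
    (length A1 * length A2 ≤ ((n1 + l1 ∸ t ∸ 1) C (l1 ∸ t ∸ 1)) * ((n2 + l2 ∸ t ∸ 1) C (l2 ∸ t ∸ 1)))
    × ((length A1 * length A2 ≡ ((n1 + l1 ∸ t ∸ 1) C (l1 ∸ t ∸ 1)) * ((n2 + l2 ∸ t ∸ 1) C (l2 ∸ t ∸ 1)))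
    ⇔ (∃[ T ] (∣ T ∣ ≡ t × IsStar n1 (inj₁ {l1} {l2}) T A1 × IsStar n2 (inj₂ {l1} {l2}) T A2)))
theorem2p1 l1 l2 t _ _ _ t+2≤m
  with split-length (≤-trans t+2≤m (m⊓n≤m l1 l2)) | split-length (≤-trans t+2≤m (m⊓n≤n l1 l2))
... | g1 , l1≡ | g2 , l2≡ = suc (K * L) , λ n1 n2 n0≤n1 n0≤n2 A1 A2 F1 F2 cross →
  let open TwoFamilies {g1 = g1} {g2 = g2} l1≡ l2≡ F1 F2 cross
      binomials = cong₂ _*_ (binomial≡nComp n1 l1≡) (binomial≡nComp n2 l2≡)
      (bound , extremal) = conclusion (≤-trans (s≤s z≤n) n0≤n1) (≤-trans (s≤s z≤n) n0≤n2)
        (*-≤-threshold (m≤m+n K₁ K₂) (≤-trans (split-length⇒suc≤ l1≡) (m≤m+n l1 l2)) n0≤n1)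
        (*-≤-threshold (m≤n+m K₂ K₁) (≤-trans (split-length⇒suc≤ l2≡) (m≤n+m l2 l1)) n0≤n2)
  in subst (length A1 * length A2 ≤_) (sym binomials) bound ,
     mk⇔ (λ eq → extremal (trans eq binomials)) (λ ext → trans (Extremal⇒≡ ext) (sym binomials))
  where
  m K₁ K₂ K L : ℕ
  m = l1 ⊓ l2
  K₁ = 2 ^ m * (2 ^ m * m)
  K₂ = 2 ^ m * m
  K = K₁ + K₂
  L = l1 + l2
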